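{- Let $L_0,L_1,\ldots$ be a uniform sequence of supersolvable geometric lattices (with accompanying data $\iota_n,\theta_s,t_n$ as in the context), and for $n\ge1$ let $a_n$ be the number of atoms of $L_n$ minus the number of atoms of $L_{n-1}$. Then for every $k\ge1$, \[F(\mathcal{L}^{(k)}_\infty;x)=\frac{1}{(1-a_1x)(1-a_2x)\cdots(1-a_kx)}.\]
   Context: A finite lattice is semimodular if it is graded with rank $\rho$ and $\rho(p)+\rho(q)\ge\rho(p\vee q)+\rho(p\wedge q)$; geometric if semimodular and atomic. An element $p$ is modular if $\rho(p)+\rho(q)=\rho(p\vee q)+\rho(p\wedge q)$ for all $q$. A uniform sequence of supersolvable geometric lattices is a sequence of finite geometric lattices $L_0,L_1,\ldots$ with $L_n$ of rank $n$ and $[a,\hat1_{L_n}]\cong L_{n-1}$ for every atom $a\in L_n$, together with fixed isomorphisms $\theta_s:[s,\hat1_{L_n}]\to L_{n-1}$ for each atom $s\in L_n$ and fixed embeddings (isomorphisms onto image) $\iota_n:L_n\to L_{n+1}$ satisfying (i) $\iota_{n-1}(\theta_s(x))=\theta_{\iota_n(s)}(\iota_n(x))$ for every atom $s\in L_n$ and $x\in[s,\hat1_{L_n}]$, and (ii) the image of $\iota_n$ is $[\hat0_{L_{n+1}},t_n]$ for a modular coatom $t_n\in L_{n+1}$. $\mathcal{L}_\infty=\bigsqcup_nL_n/\sim$, where $\sim$ is generated by $x\sim\iota_n(x)$; $[x]\le[y]$ iff $x'\le y'$ in some $L_n$ for representatives $x',y'$; $\rho([x])=\rho(x)$; $\nu([x])=\min\{n:$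 some representative of $[x]$ lies in $L_n\}$. $\mathcal{L}^{(k)}_\infty=\{[x]:\nu([x])-\rho([x])<k\}$ with the induced order. For a finite type $\mathbb{N}$-graded poset $\mathcal{P}$ (minimum, rank function, finitely many elements of each rank), $F(\mathcal{P};x)=\sum_{p\in\mathcal{P}}x^{\rho(p)}$. -}

module Defs where

open import Data.Nat using (ℕ; zero; suc; _+_; _∸_; _≤_; _<_)
open import Data.Integer as ℤ using (ℤ; +_)
open import Data.List using (List; []; _∷_; length; foldr)
open import Data.List.Membership.Propositional using (_∈_)
open import Data.List.Relation.Unary.All using (All)
open import Data.List.Relation.Unary.Any using (Any)
open import Data.List.Relation.Unary.AllPairs using (AllPairs)
open import Data.List.Relation.Unary.Unique.Propositional using (Unique)
open import Data.Product using (Σ; ∃; _×_; _,_; proj₁; proj₂)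
open import Relation.Binary.PropositionalEquality using (_≡_; _≢_)
open import Relation.Binary.Definitions using (DecidableEquality; Decidable)
open import Relation.Nullary using (¬_)
open import Function.Bundles using (_⇔_)

record FinLattice : Set₁ where
  field
    Carrier  : Set
    _⊑_      : Carrier → Carrier → Set
    _≟_      : DecidableEquality Carrier
    _⊑?_     : Decidable _⊑_
    elems    : List Carrier
    complete : ∀ x → x ∈ elems
    ⊑-refl    : ∀ x → x ⊑ x
    ⊑-trans   : ∀ {x y z} → x ⊑ y → y ⊑ z → x ⊑ z
    ⊑-antisym : ∀ {x y} → x ⊑ y → y ⊑ x → x ≡ y
    _∨_ _∧_  : Carrier → Carrier → Carrier
    ∨-upperˡ : ∀ x y → x ⊑ (x ∨ y)
    ∨-upperʳ : ∀ x y → y ⊑ (x ∨ y)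
    ∨-least  : ∀ {x y z} → x ⊑ z → y ⊑ z → (x ∨ y) ⊑ z
    ∧-lowerˡ : ∀ x y → (x ∧ y) ⊑ x
    ∧-lowerʳ : ∀ x y → (x ∧ y) ⊑ y
    ∧-greatest : ∀ {x y z} → z ⊑ x → z ⊑ y → z ⊑ (x ∧ y)
    bot top  : Carrier
    bot-min  : ∀ x → bot ⊑ x
    top-max  : ∀ x → x ⊑ top

open FinLattice public

module _ (L : FinLattice) where
  private
    C = Carrier L
    _⊑L_ = _⊑_ L

  Lt : C → C → Set
  Lt x y = (x ⊑L y) × (x ≢ y)

  Covers : C → C → Set
  Covers x y = Lt x y × (∀ z → Lt x z → z ⊑L y → z ≡ y)

  IsAtom : C → Set
  IsAtom a = Covers (bot L) a

  IsCoatom : C → Set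
  IsCoatom t = Covers t (top L)

  IsGradedBy : (C → ℕ) → Set
  IsGradedBy ρ = (ρ (bot L) ≡ 0) × (∀ x y → Covers x y → ρ y ≡ suc (ρ x))

  IsSemimodular : (C → ℕ) → Set
  IsSemimodular ρ = IsGradedBy ρ ×
    (∀ p q → ρ (_∨_ L p q) + ρ (_∧_ L p q) ≤ ρ p + ρ q)

  joinAll : List C → C
  joinAll = foldr (_∨_ L) (bot L)

  IsAtomic : Set
  IsAtomic = ∀ x → ∃ λ (as : List C) → All IsAtom as × joinAll as ≡ x

  IsGeometric : (C → ℕ) → Set
  IsGeometric ρ = IsSemimodular ρ × IsAtomic

  IsModularElem : (C → ℕ) → C → Set
  IsModularElem ρ p = ∀ q → ρ p + ρ q ≡ ρ (_∨_ L p q) + ρ (_∧_ L p q)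

  HasAtomCount : ℕ → Set
  HasAtomCount m = Σ (List C) λ xs →
    Unique xs × All IsAtom xs × (∀ a → IsAtom a → a ∈ xs) × (length xs ≡ m)

-- θ restricted to [s, top] is an order isomorphism onto M
-- (θ is a total function; its values outside [s, top] are irrelevant)
IntervalIso : (L M : FinLattice) → Carrier L → (Carrier L → Carrier M) → Set
IntervalIso L M s θ =
  (∀ x y → _⊑_ L s x → _⊑_ L s y → (_⊑_ L x y ⇔ _⊑_ M (θ x) (θ y))) ×
  (∀ m → ∃ λ x → _⊑_ L s x × θ x ≡ m)

EmbedsOnto : (L M : FinLattice) → (Carrier L → Carrier M) → Carrier M → Set
EmbedsOnto L M ι t =
  (∀ x y → (_⊑_ L x y ⇔ _⊑_ M (ι x) (ι y))) ×
  (∀ y → (_⊑_ M y t ⇔ ∃ λ x → ι x ≡ y))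

record UniformSeq : Set₁ where
  field
    L     : ℕ → FinLattice
    ρ     : (n : ℕ) → Carrier (L n) → ℕ
    geometric : ∀ n → IsGeometric (L n) (ρ n)
    rank-top  : ∀ n → ρ n (top (L n)) ≡ n
    θ     : (n : ℕ) → Carrier (L (suc n)) → Carrier (L (suc n)) → Carrier (L n)
    θ-iso : ∀ n s → IsAtom (L (suc n)) s → IntervalIso (L (suc n)) (L n) s (θ n s)
    ι     : (n : ℕ) → Carrier (L n) → Carrier (L (suc n))
    t     : (n : ℕ) → Carrier (L (suc n))
    t-coatom  : ∀ n → IsCoatom (L (suc n)) (t n)
    t-modular : ∀ n → IsModularElem (L (suc n)) (ρ (suc n)) (t n)
    ι-emb     : ∀ n → EmbedsOnto (L n) (L (suc n)) (ι n) (t n)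
    compat : ∀ n s x → IsAtom (L (suc n)) s → _⊑_ (L (suc n)) s x →
             ι n (θ n s x) ≡ θ (suc n) (ι (suc n) s) (ι (suc n) x)

module _ (U : UniformSeq) where
  open UniformSeq U

  El : Set
  El = Σ ℕ λ n → Carrier (L n)

  rankEl : El → ℕ
  rankEl (n , x) = ρ n x

  data _∼_ : El → El → Set where
    step  : ∀ n x → (n , x) ∼ (suc n , ι n x)
    ∼refl : ∀ e → e ∼ e
    ∼sym  : ∀ {e e'} → e ∼ e' → e' ∼ e
    ∼trans : ∀ {e e' e''} → e ∼ e' → e' ∼ e'' → e ∼ e''

  -- [e] ∈ L^(k)_∞ :  ν([e]) - ρ([e]) < k, i.e. some representative (m , y)
  -- of [e] has m < ρ(y) + k  (ν is the least such m)
  InLk : ℕ → El → Set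
  InLk k e = ∃ λ e' → e ∼ e' × (proj₁ e' < rankEl e' + k)

  RankTransversal : ℕ → ℕ → List El → Set
  RankTransversal k r T =
    All (λ e → InLk k e × rankEl e ≡ r) T ×
    AllPairs (λ e e' → ¬ (e ∼ e')) T ×
    (∀ e → InLk k e → rankEl e ≡ r → Any (e ∼_) T)

-- Formal power series over ℤ, as coefficient functions

δ₀ : ℕ → ℤ
δ₀ zero    = + 1
δ₀ (suc _) = + 0

-- coefficients of ∏_{a ∈ as} (1 - a x)
linProd : List ℤ → ℕ → ℤ
linProd []       j       = δ₀ j
linProd (a ∷ as) zero    = linProd as zero
linProd (a ∷ as) (suc j) = linProd as (suc j) ℤ.- a ℤ.* linProd as j

convAux : (ℕ → ℤ) → (ℕ → ℤ) → ℕ → ℕ → ℤ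
convAux f g r zero    = f 0 ℤ.* g r
convAux f g r (suc m) = convAux f g r m ℤ.+ f (suc m) ℤ.* g (r ∸ suc m)

seriesMul : (ℕ → ℤ) → (ℕ → ℤ) → ℕ → ℤ
seriesMul f g r = convAux f g r r

aSeq : (ℕ → ℕ) → ℕ → ℤ
aSeq A i = (+ A i) ℤ.- (+ A (i ∸ 1))

aList : (ℕ → ℕ) → ℕ → List ℤ
aList A zero    = []
aList A (suc k) = aSeq A (suc k) ∷ aList A k

{-# OPTIONS --safe #-}
-- Let W n r be the number of rank-r elements of L_n.  An element of rank r of L_n
-- has exactly A (n - r) upper covers: for r > 0 pass to an atom s below it and use
-- [s, 1] ≅ L_(n-1).  The rank-(r+1) elements of L_(n+1) below the modular coatom t_n
-- form a copy of L_n, and an element y not below t_n covers exactly one element below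
-- t_n, namely t_n ∧ y, which has rank r by modularity.  Of the A (n+1-r) covers of a
-- rank-r element z below t_n, exactly A (n-r) lie below t_n (they come from L_n), hence
--   W (n+1) (r+1) = W n (r+1) + (A (n+1-r) - A (n-r)) W n r.
-- Every rank-r element of L^(k)_∞ has exactly one representative in L_(r+k-1), so
-- F(L^(k)_∞) has coefficients G_k r = W (r+k-1) r, and the recursion says
-- (1 - a_k x) G_k = G_(k-1), with G_0 = 1.

module Submission where

open import Defs
open import Data.Nat using (ℕ; _≤_)
open import Data.Integer using (+_)
open import Data.List using (List; length)
open import Data.Product using (Σ; _×_)
open import Relation.Binary.PropositionalEquality using (_≡_)

module PowerSeries where

  open import Data.Nat as ℕ using (ℕ; zero; suc; _∸_; _<_; s≤s)
  open import Data.Nat.Properties using (≤-refl; ≤-reflexive; <-trans; n∸n≡0; +-suc; m+n∸m≡n)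
  import Data.Nat.Properties as ℕ
  open import Data.Integer using (ℤ; +_; _+_; _*_; _-_)
  open import Data.Integer.Properties using (*-identityˡ; +-identityʳ; pos-+; pos-*)
  open import Data.Integer.Tactic.RingSolver using (solve-∀)
  open import Relation.Binary.PropositionalEquality
  open import Data.List using (_∷_)

  timesOneMinus : ℤ → (ℕ → ℤ) → ℕ → ℤ
  timesOneMinus a f zero    = f zero
  timesOneMinus a f (suc j) = f (suc j) - a * f j

  linProd-∷ : ∀ a as j → linProd (a ∷ as) j ≡ timesOneMinus a (linProd as) j
  linProd-∷ a as zero    = refl
  linProd-∷ a as (suc j) = refl

  convAux-cong : ∀ {f f′ g g′} → f ≗ f′ → g ≗ g′ → ∀ r m → convAux f g r m ≡ convAux f′ g′ r m
  convAux-cong f≗f′ g≗g′ r zero    = cong₂ _*_ (f≗f′ 0) (g≗g′ r)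
  convAux-cong f≗f′ g≗g′ r (suc m) =
    cong₂ _+_ (convAux-cong f≗f′ g≗g′ r m) (cong₂ _*_ (f≗f′ (suc m)) (g≗g′ _))

  seriesMul-cong : ∀ {f f′ g g′} → f ≗ f′ → g ≗ g′ → ∀ r → seriesMul f g r ≡ seriesMul f′ g′ r
  seriesMul-cong f≗f′ g≗g′ r = convAux-cong f≗f′ g≗g′ r r

  seriesMul-identityˡ : ∀ g r → seriesMul δ₀ g r ≡ g r
  seriesMul-identityˡ g r = go r
    where
    go : ∀ m → convAux δ₀ g r m ≡ g r
    go zero    = *-identityˡ (g r)
    go (suc m) = trans (+-identityʳ _) (go m)

  private
    shift : ∀ a x y y′ → x * y ≡ x * (y - a * y′) + a * x * y′
    shift = solve-∀
    regroup : ∀ a X x x′ y y′ → (X + a * x * y) + (x′ - a * x) * y ≡ (X + x′ * (y - a * y′)) + a * x′ * y′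
    regroup = solve-∀
    cancel : ∀ a X x x′ y → (X + a * x * y) + (x′ - a * x) * y ≡ X + x′ * y
    cancel = solve-∀
    move : ∀ x a b w → x - (b - a) * w ≡ (x + a * w) - b * w
    move = solve-∀
    unmove : ∀ y b w → (y + b * w) - b * w ≡ y
    unmove = solve-∀

  balanced⇒difference : ∀ x y a b w → x ℕ.+ a ℕ.* w ≡ y ℕ.+ b ℕ.* w → + x - (+ b - + a) * + w ≡ + y
  balanced⇒difference x y a b w balanced = begin
    + x - (+ b - + a) * + w          ≡⟨ move (+ x) (+ a) (+ b) (+ w) ⟩
    (+ x + + a * + w) - + b * + w    ≡⟨ cong (_- + b * + w) (embed x a) ⟨
    + (x ℕ.+ a ℕ.* w) - + b * + w    ≡⟨ cong (λ k → + k - + b * + w) balanced ⟩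
    + (y ℕ.+ b ℕ.* w) - + b * + w    ≡⟨ cong (_- + b * + w) (embed y b) ⟩
    (+ y + + b * + w) - + b * + w    ≡⟨ unmove (+ y) (+ b) (+ w) ⟩
    + y                              ∎
    where
    open ≡-Reasoning
    embed : ∀ p q → + (p ℕ.+ q ℕ.* w) ≡ + p + + q * + w
    embed p q = trans (pos-+ p (q ℕ.* w)) (cong₂ _+_ (refl {x = + p}) (pos-* q w))

  module _ (a : ℤ) (f g : ℕ → ℤ) where

    private
      ∸-suc : ∀ r m → m < r → r ∸ m ≡ suc (r ∸ suc m)
      ∸-suc (suc r) zero    _         = refl
      ∸-suc (suc r) (suc m) (s≤s m<r) = ∸-suc r m m<r

    -- Partial sums of the two sides of seriesMul-timesOneMinus differ by a single boundary term.
    convAux-timesOneMinus : ∀ r m → m < r →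
      convAux (timesOneMinus a f) g r m ≡ convAux f (timesOneMinus a g) r m + a * f m * g (r ∸ suc m)
    convAux-timesOneMinus (suc r) zero    _   = shift a (f 0) (g (suc r)) (g r)
    convAux-timesOneMinus r       (suc m) m<r = begin
      convAux (timesOneMinus a f) g r m + (f (suc m) - a * f m) * g (r ∸ suc m)
        ≡⟨ cong (_+ (f (suc m) - a * f m) * g (r ∸ suc m)) (convAux-timesOneMinus r m (<-trans ≤-refl m<r)) ⟩
      (X + a * f m * g (r ∸ suc m)) + (f (suc m) - a * f m) * g (r ∸ suc m)
        ≡⟨ cong (λ k → (X + a * f m * g k) + (f (suc m) - a * f m) * g k) (∸-suc r (suc m) m<r) ⟩
      (X + a * f m * g (suc d)) + (f (suc m) - a * f m) * g (suc d)
        ≡⟨ regroup a X (f m) (f (suc m)) (g (suc d)) (g d) ⟩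
      (X + f (suc m) * (g (suc d) - a * g d)) + a * f (suc m) * g d
        ≡⟨ cong (λ k → (X + f (suc m) * timesOneMinus a g k) + a * f (suc m) * g d) (∸-suc r (suc m) m<r) ⟨
      (X + f (suc m) * timesOneMinus a g (r ∸ suc m)) + a * f (suc m) * g d ∎
      where
      open ≡-Reasoning
      X = convAux f (timesOneMinus a g) r m
      d = r ∸ suc (suc m)

    seriesMul-timesOneMinus : ∀ r → seriesMul (timesOneMinus a f) g r ≡ seriesMul f (timesOneMinus a g) r
    seriesMul-timesOneMinus zero    = refl
    seriesMul-timesOneMinus (suc r) = begin
      convAux (timesOneMinus a f) g (suc r) r + (f (suc r) - a * f r) * g (r ∸ r)
        ≡⟨ cong (_+ (f (suc r) - a * f r) * g (r ∸ r)) (convAux-timesOneMinus (suc r) r ≤-refl) ⟩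
      (X + a * f r * g (r ∸ r)) + (f (suc r) - a * f r) * g (r ∸ r)
        ≡⟨ cancel a X (f r) (f (suc r)) (g (r ∸ r)) ⟩
      X + f (suc r) * g (r ∸ r)
        ≡⟨ cong (λ y → X + f (suc r) * y) (unchanged-at-0 (n∸n≡0 r)) ⟩
      X + f (suc r) * timesOneMinus a g (r ∸ r) ∎
      where
      open ≡-Reasoning
      X = convAux f (timesOneMinus a g) (suc r) r
      unchanged-at-0 : ∀ {k} → k ≡ 0 → g k ≡ timesOneMinus a g k
      unchanged-at-0 refl = refl

  module _ (A : ℕ → ℕ) (W : ℕ → ℕ → ℕ)
           (W-0 : ∀ n → W n 0 ≡ 1)
           (W-above : ∀ n r → n < r → W n r ≡ 0)
           (W-rec : ∀ n r → W (suc n) (suc r) ℕ.+ A (n ∸ r) ℕ.* W n r ≡ W n (suc r) ℕ.+ A (suc n ∸ r) ℕ.* W n r)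
           where

    -- For W the Whitney numbers, diagonal j r counts the rank-r elements of L^(j)_∞.
    diagonal : ℕ → ℕ → ℤ
    diagonal j r = + W (r ℕ.+ j ∸ 1) r

    diagonal-0 : ∀ r → diagonal 0 r ≡ δ₀ r
    diagonal-0 zero    = cong +_ (W-0 0)
    diagonal-0 (suc r) = cong +_ (W-above (r ℕ.+ 0) (suc r) (s≤s (≤-reflexive (ℕ.+-identityʳ r))))

    diagonal-step : ∀ j r → timesOneMinus (aSeq A (suc j)) (diagonal (suc j)) r ≡ diagonal j r
    diagonal-step j zero    = cong +_ (trans (W-0 j) (sym (W-0 (j ∸ 1))))
    diagonal-step j (suc i) = begin
      + W (i ℕ.+ suc j) (suc i) - aSeq A (suc j) * + W (i ℕ.+ suc j ∸ 1) i
        ≡⟨ cong₂ (λ m m′ → + W m (suc i) - aSeq A (suc j) * + W m′ i) (+-suc i j) (cong (_∸ 1) (+-suc i j)) ⟩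
      + W (suc n) (suc i) - (+ A (suc j) - + A j) * + W n i
        ≡⟨ cong₂ (λ p q → + W (suc n) (suc i) - (+ A p - + A q) * + W n i) (sym suc-n∸i) (sym (m+n∸m≡n i j)) ⟩
      + W (suc n) (suc i) - (+ A (suc n ∸ i) - + A (n ∸ i)) * + W n i
        ≡⟨ balanced⇒difference (W (suc n) (suc i)) (W n (suc i)) (A (n ∸ i)) (A (suc n ∸ i)) (W n i) (W-rec n i) ⟩
      + W n (suc i) ∎
      where
      open ≡-Reasoning
      n = i ℕ.+ j
      suc-n∸i : suc n ∸ i ≡ suc j
      suc-n∸i = trans (cong (_∸ i) (sym (+-suc i j))) (m+n∸m≡n i (suc j))

    generating-function : ∀ j r → seriesMul (linProd (aList A j)) (diagonal j) r ≡ δ₀ r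
    generating-function zero    r = trans (seriesMul-identityˡ (diagonal 0) r) (diagonal-0 r)
    generating-function (suc j) r = begin
      seriesMul (linProd (aList A (suc j))) (diagonal (suc j)) r
        ≡⟨ seriesMul-cong (linProd-∷ (aSeq A (suc j)) (aList A j)) (λ _ → refl) r ⟩
      seriesMul (timesOneMinus (aSeq A (suc j)) (linProd (aList A j))) (diagonal (suc j)) r
        ≡⟨ seriesMul-timesOneMinus (aSeq A (suc j)) (linProd (aList A j)) (diagonal (suc j)) r ⟩
      seriesMul (linProd (aList A j)) (timesOneMinus (aSeq A (suc j)) (diagonal (suc j))) r
        ≡⟨ seriesMul-cong (λ _ → refl) (diagonal-step j) r ⟩
      seriesMul (linProd (aList A j)) (diagonal j) r
        ≡⟨ generating-function j r ⟩
      δ₀ r ∎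
      where open ≡-Reasoning

-- Opened only here: inside PowerSeries these operators would clash with those of ℤ.
open import Data.Nat using (zero; suc; _+_; _*_; _∸_; _<_; _≤′_; ≤′-refl; ≤′-step; z≤n; s≤s)
  renaming (_≟_ to _≟ℕ_)
open import Data.Nat.Properties
  using (≤-refl; ≤-reflexive; ≤-trans; ≤-antisym; m≤n⇒m≤1+n; <⇒≢; <⇒≱; 1+n≢n; 0≢1+n; suc-injective;
         +-comm; +-assoc; +-suc; +-identityʳ; *-suc; *-zeroʳ; +-cancelˡ-≡; +-cancelʳ-≡; m<m+n; m≤n+m;
         ∸-monoˡ-≤; ∸-monoʳ-<; ≤⇒≤′; +-commutativeSemigroup; module ≤-Reasoning)
open import Data.Nat.Induction using (<-wellFounded)
open import Algebra.Properties.CommutativeSemigroup +-commutativeSemigroup using (interchange)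
open import Data.Empty using (⊥)
open import Data.List using ([]; _∷_; _++_; filter; map; concatMap; deduplicate)
open import Data.List.Properties using (length-map; length-++)
open import Data.List.Membership.Propositional using (_∈_; find; lose)
open import Data.List.Membership.Propositional.Properties
  using (∈-length; ∈-filter⁺; ∈-filter⁻; ∈-map⁺; ∈-map⁻; ∈-deduplicate⁺; ∈-concatMap⁺; ∈-concatMap⁻)
open import Data.List.Membership.Propositional.Properties.WithK using (unique∧set⇒bag)
open import Data.List.Relation.Binary.BagAndSetEquality using (∼bag⇒↭)
open import Data.List.Relation.Binary.Permutation.Propositional.Properties using (↭-length)
import Data.List.Relation.Unary.All as All
open import Data.List.Relation.Unary.All using ([]; _∷_)
import Data.List.Relation.Unary.All.Properties as AllP
import Data.List.Relation.Unary.Any as Any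
open import Data.List.Relation.Unary.Any using (here; there)
import Data.List.Relation.Unary.Any.Properties as AnyP
import Data.List.Relation.Unary.AllPairs as AllPairs
open import Data.List.Relation.Unary.AllPairs using ([]; _∷_)
import Data.List.Relation.Unary.AllPairs.Properties as AllPairsP
open import Data.List.Relation.Unary.Unique.Propositional using (Unique)
import Data.List.Relation.Unary.Unique.Propositional.Properties as Unique
open import Data.List.Relation.Unary.Unique.DecPropositional.Properties using (deduplicate-!)
open import Data.Product using (∃; ∃₂; _,_; proj₁; proj₂)
open import Data.Product.Properties.WithK using (,-injectiveʳ)
open import Function.Base using (_∘_; id; flip; case_of_)
open import Function.Bundles using (_⇔_; mk⇔; Equivalence)
open import Induction.WellFounded using (WellFounded; Acc; acc; module Subrelation)
open import Level using (0ℓ)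
import Relation.Binary.Construct.On as On
open import Relation.Binary.PropositionalEquality
  using (_≢_; refl; sym; trans; cong; cong₂; subst; subst₂; module ≡-Reasoning)
open import Relation.Nullary using (¬_; Dec; yes; no; ¬?; contradiction)
open import Relation.Nullary.Decidable using (_×-dec_; _→-dec_; map′; decidable-stable)
open import Relation.Unary using (Pred; Decidable)
open import Relation.Unary.Properties using (_∩?_; ∁?)

open PowerSeries using (seriesMul-cong; generating-function)

private
  variable
    A B : Set

unique∧set⇒length≡ : {xs ys : List A} → Unique xs → Unique ys →
                     (∀ {x} → x ∈ xs ⇔ x ∈ ys) → length xs ≡ length ys
unique∧set⇒length≡ u v same = ↭-length (∼bag⇒↭ (unique∧set⇒bag u v same))

module _ (F : A → List B) where

  unique-concatMap : ∀ {zs} → Unique zs → (∀ {z} → z ∈ zs → Unique (F z)) →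
                     (∀ {z z′ y} → z ∈ zs → z′ ∈ zs → y ∈ F z → y ∈ F z′ → z ≡ z′) →
                     Unique (concatMap F zs)
  unique-concatMap {[]}     _        _     _      = []
  unique-concatMap {z ∷ zs} (z∉ ∷ u) uniqF fibres =
    Unique.++⁺ (uniqF (here refl))
               (unique-concatMap u (uniqF ∘ there) λ z∈ z′∈ → fibres (there z∈) (there z′∈))
               disjoint
    where
    disjoint : ∀ {y} → y ∈ F z × y ∈ concatMap F zs → ⊥
    disjoint (y∈Fz , y∈rest) with find (∈-concatMap⁻ F y∈rest)
    ... | z′ , z′∈zs , y∈Fz′ = All.lookup z∉ z′∈zs (fibres (here refl) (there z′∈zs) y∈Fz y∈Fz′)

  length-concatMap : (a b : ℕ) → ∀ zs → (∀ {z} → z ∈ zs → length (F z) + a ≡ b) →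
                     length (concatMap F zs) + a * length zs ≡ b * length zs
  length-concatMap a b []       _     = trans (*-zeroʳ a) (sym (*-zeroʳ b))
  length-concatMap a b (z ∷ zs) fibre = begin
    length (F z ++ concatMap F zs) + a * suc (length zs)             ≡⟨ cong₂ _+_ (length-++ (F z)) (*-suc a _) ⟩
    (length (F z) + length (concatMap F zs)) + (a + a * length zs)   ≡⟨ interchange (length (F z)) _ a _ ⟩
    (length (F z) + a) + (length (concatMap F zs) + a * length zs)   ≡⟨ cong₂ _+_ (fibre (here refl))
                                                                          (length-concatMap a b zs (fibre ∘ there)) ⟩
    b + b * length zs                                                ≡⟨ *-suc b _ ⟨
    b * suc (length zs)                                              ∎
    where open ≡-Reasoning

measure-wellFounded : {_≺_ : A → A → Set} (m : A → ℕ) → (∀ {x y} → x ≺ y → m x < m y) → WellFounded _≺_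
measure-wellFounded m decreasing = Subrelation.wellFounded decreasing (On.wellFounded m <-wellFounded)

-- elems L may contain repetitions.
enum : (L : FinLattice) → List (Carrier L)
enum L = deduplicate (_≟_ L) (elems L)

count : (L : FinLattice) {P : Pred (Carrier L) 0ℓ} → Decidable P → ℕ
count L P? = length (filter P? (enum L))

module _ (L : FinLattice) {P : Pred (Carrier L) 0ℓ} (P? : Decidable P) where

  ∈-filter-enum : ∀ {x} → x ∈ filter P? (enum L) ⇔ P x
  ∈-filter-enum = mk⇔ (proj₂ ∘ ∈-filter⁻ P? {xs = enum L})
                      (∈-filter⁺ P? (∈-deduplicate⁺ (_≟_ L) (complete L _)))

  unique-filter-enum : Unique (filter P? (enum L))
  unique-filter-enum = Unique.filter⁺ P? (deduplicate-! (_≟_ L) (elems L))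

  count-enumeration : ∀ {xs} → Unique xs → (∀ {x} → x ∈ xs ⇔ P x) → count L P? ≡ length xs
  count-enumeration u xs⇔P =
    unique∧set⇒length≡ unique-filter-enum u
      (mk⇔ (Equivalence.from xs⇔P ∘ Equivalence.to ∈-filter-enum)
           (Equivalence.from ∈-filter-enum ∘ Equivalence.to xs⇔P))

  count-pos : ∀ {x} → P x → 0 < count L P?
  count-pos = ∈-length ∘ Equivalence.from ∈-filter-enum

  count-partition : {Q : Pred (Carrier L) 0ℓ} (Q? : Decidable Q) →
                    count L P? ≡ count L (P? ∩? Q?) + count L (P? ∩? ∁? Q?)
  count-partition Q? = split (enum L)
    where
    split : ∀ xs → length (filter P? xs) ≡ length (filter (P? ∩? Q?) xs) + length (filter (P? ∩? ∁? Q?) xs)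
    split []       = refl
    split (x ∷ xs) with P? x | Q? x
    ... | yes _ | yes _ = cong suc (split xs)
    ... | yes _ | no  _ = trans (cong suc (split xs)) (sym (+-suc _ _))
    ... | no  _ | _     = split xs

count-image : (L M : FinLattice) {P : Pred (Carrier L) 0ℓ} {Q : Pred (Carrier M) 0ℓ}
              (P? : Decidable P) (Q? : Decidable Q) (f : Carrier L → Carrier M) →
              (∀ {x y} → f x ≡ f y → x ≡ y) →
              (∀ {x} → P x → Q (f x)) → (∀ {y} → Q y → ∃ λ x → P x × f x ≡ y) →
              count L P? ≡ count M Q?
count-image L M {Q = Q} P? Q? f f-injective P⇒Q∘f Q⇒image = begin
  length (filter P? (enum L))          ≡⟨ length-map f (filter P? (enum L)) ⟨
  length (map f (filter P? (enum L)))  ≡⟨ count-enumeration M Q? (Unique.map⁺ f-injective (unique-filter-enum L P?))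
                                                               (mk⇔ to from) ⟨
  count M Q?                           ∎
  where
  open ≡-Reasoning
  to : ∀ {y} → y ∈ map f (filter P? (enum L)) → Q y
  to y∈ with ∈-map⁻ f y∈
  ... | x , x∈ , refl = P⇒Q∘f (Equivalence.to (∈-filter-enum L P?) x∈)
  from : ∀ {y} → Q y → y ∈ map f (filter P? (enum L))
  from Qy with Q⇒image Qy
  ... | x , Px , refl = ∈-map⁺ f (Equivalence.from (∈-filter-enum L P?) Px)

module _ (L : FinLattice) {P : Pred (Carrier L) 0ℓ} (P? : Decidable P) where

  count-cong : {Q : Pred (Carrier L) 0ℓ} (Q? : Decidable Q) → (∀ {x} → P x ⇔ Q x) → count L P? ≡ count L Q?
  count-cong Q? P⇔Q = count-image L L P? Q? id id (Equivalence.to P⇔Q) λ Qx → _ , Equivalence.from P⇔Q Qx , refl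

  count-< : {Q : Pred (Carrier L) 0ℓ} (Q? : Decidable Q) → (∀ {x} → P x → Q x) →
            ∀ {w} → Q w → ¬ P w → count L P? < count L Q?
  count-< Q? P⊆Q Qw ¬Pw = begin-strict
    count L P?                                   ≡⟨ count-cong (Q? ∩? P?) (mk⇔ (λ Px → P⊆Q Px , Px) proj₂) ⟩
    count L (Q? ∩? P?)                           <⟨ m<m+n _ (count-pos L (Q? ∩? ∁? P?) (Qw , ¬Pw)) ⟩
    count L (Q? ∩? P?) + count L (Q? ∩? ∁? P?)   ≡⟨ count-partition L Q? P? ⟨
    count L Q?                                   ∎
    where open ≤-Reasoning

module _ (L : FinLattice) {P Q : Pred (Carrier L) 0ℓ} {R : Carrier L → Pred (Carrier L) 0ℓ}
         (P? : Decidable P) (Q? : Decidable Q) (R? : ∀ z → Decidable (R z))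
         (g : Carrier L → Carrier L)
         (P⇒fibre : ∀ {y} → P y → Q (g y) × R (g y) y)
         (fibre⇒P : ∀ {z y} → Q z → R z y → P y)
         (fibre⇒g : ∀ {z y} → Q z → R z y → g y ≡ z) where

  count-fibres : ∀ a b → (∀ {z} → Q z → count L (R? z) + a ≡ b) →
                 count L P? + a * count L Q? ≡ b * count L Q?
  count-fibres a b fibre-size = begin
    count L P? + a * count L Q?               ≡⟨ cong (_+ a * count L Q?) (count-enumeration L P? unique (mk⇔ to from)) ⟩
    length (concatMap F zs) + a * length zs   ≡⟨ length-concatMap F a b zs (fibre-size ∘ Q-of) ⟩
    b * count L Q?                            ∎
    where
    open ≡-Reasoning
    zs = filter Q? (enum L)
    F : Carrier L → List (Carrier L)
    F z = filter (R? z) (enum L)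
    Q-of : ∀ {z} → z ∈ zs → Q z
    Q-of = Equivalence.to (∈-filter-enum L Q?)
    R-of : ∀ {z y} → y ∈ F z → R z y
    R-of {z} = Equivalence.to (∈-filter-enum L (R? z))
    unique : Unique (concatMap F zs)
    unique = unique-concatMap F (unique-filter-enum L Q?) (λ {z} _ → unique-filter-enum L (R? z))
      λ z∈ z′∈ y∈ y∈′ → trans (sym (fibre⇒g (Q-of z∈) (R-of y∈))) (fibre⇒g (Q-of z′∈) (R-of y∈′))
    to : ∀ {y} → y ∈ concatMap F zs → P y
    to y∈ with find (∈-concatMap⁻ F y∈)
    ... | z , z∈ , y∈Fz = fibre⇒P (Q-of z∈) (R-of y∈Fz)
    from : ∀ {y} → P y → y ∈ concatMap F zs
    from {y} Py = let Qgy , Rgy = P⇒fibre Py in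
      ∈-concatMap⁺ F (lose (Equivalence.from (∈-filter-enum L Q?) Qgy)
                           (Equivalence.from (∈-filter-enum L (R? (g y))) Rgy))

module FiniteOrder (L : FinLattice) where

  private
    C = Carrier L
    _≼_ = _⊑_ L
    _≺_ = Lt L
    _⋖_ = Covers L

  _≺?_ : ∀ x y → Dec (x ≺ y)
  x ≺? y = _⊑?_ L x y ×-dec ¬? (_≟_ L x y)

  ∀? : {P : Pred C 0ℓ} → Decidable P → Dec (∀ z → P z)
  ∀? P? = map′ (λ all z → All.lookup all (complete L z)) (λ ∀P → All.tabulate λ {z} _ → ∀P z)
               (All.all? P? (elems L))

  _⋖?_ : ∀ x y → Dec (x ⋖ y)
  x ⋖? y = x ≺? y ×-dec ∀? (λ z → x ≺? z →-dec (_⊑?_ L z y →-dec _≟_ L z y))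

  -- Going up strictly enlarges the down-set and shrinks the up-set of an element.
  ≺-wellFounded : WellFounded _≺_
  ≺-wellFounded = measure-wellFounded (λ x → count L (λ w → _⊑?_ L w x))
    λ {x} {y} (x≼y , x≢y) → count-< L (λ w → _⊑?_ L w x) (λ w → _⊑?_ L w y)
      (λ w≼x → ⊑-trans L w≼x x≼y) (⊑-refl L y) (λ y≼x → x≢y (⊑-antisym L x≼y y≼x))

  ≻-wellFounded : WellFounded (flip _≺_)
  ≻-wellFounded = measure-wellFounded (λ x → count L (_⊑?_ L x))
    λ {y} {x} (x≼y , x≢y) → count-< L (_⊑?_ L y) (_⊑?_ L x)
      (⊑-trans L x≼y) (⊑-refl L x) (λ y≼x → x≢y (⊑-antisym L x≼y y≼x))

  between : ∀ {x y} → x ≺ y → ¬ x ⋖ y → ∃ λ z → x ≺ z × z ≺ y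
  between {x} {y} x≺y x⋖̸y with Any.any? (λ z → x ≺? z ×-dec z ≺? y) (elems L)
  ... | yes found = Any.satisfied found
  ... | no  none  = contradiction (x≺y , maximal) x⋖̸y
    where
    maximal : ∀ z → x ≺ z → z ≼ y → z ≡ y
    maximal z x≺z z≼y = decidable-stable (_≟_ L z y) λ z≢y → none (lose (complete L z) (x≺z , z≼y , z≢y))

  cover-below : ∀ {x y} → x ≺ y → ∃ λ w → x ≼ w × w ⋖ y
  cover-below {x} {y} = go x (≻-wellFounded x)
    where
    go : ∀ x → Acc (flip _≺_) x → x ≺ y → ∃ λ w → x ≼ w × w ⋖ y
    go x (acc above) x≺y with x ⋖? y
    ... | yes x⋖y = x , ⊑-refl L x , x⋖y
    ... | no  x⋖̸y with between x≺y x⋖̸y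
    ... | z , x≺z , z≺y with go z (above x≺z) z≺y
    ... | w , z≼w , w⋖y = w , ⊑-trans L (proj₁ x≺z) z≼w , w⋖y

  cover-induction : ∀ {u} (P : Pred C 0ℓ) → P u → (∀ {a b} → u ≼ a → P a → a ⋖ b → P b) →
                    ∀ {x} → u ≼ x → P x
  cover-induction {u} P Pu up {x} = go x (≺-wellFounded x)
    where
    go : ∀ x → Acc _≺_ x → u ≼ x → P x
    go x (acc below) u≼x with _≟_ L u x
    ... | yes refl = Pu
    ... | no  u≢x with cover-below (u≼x , u≢x)
    ... | w , u≼w , w⋖x = up u≼w (go w (below (proj₁ w⋖x)) u≼w) w⋖x

  atom-below : IsAtomic L → ∀ {x} → x ≢ bot L → ∃ λ s → IsAtom L s × s ≼ x
  atom-below atomic {x} x≢⊥ with atomic x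
  ... | []     , _        , ⊥≡x = contradiction (sym ⊥≡x) x≢⊥
  ... | s ∷ ss , atom ∷ _ , s∨⋯≡x = s , atom , subst (s ≼_) s∨⋯≡x (∨-upperˡ L s (joinAll L ss))

  module Graded {ρ : C → ℕ} (graded : IsGradedBy L ρ) where

    rank-bot : ρ (bot L) ≡ 0
    rank-bot = proj₁ graded

    rank-cover : ∀ {x y} → x ⋖ y → ρ y ≡ suc (ρ x)
    rank-cover = proj₂ graded _ _

    rank-mono : ∀ {x y} → x ≼ y → ρ x ≤ ρ y
    rank-mono {x} = cover-induction (λ b → ρ x ≤ ρ b) ≤-refl
      λ _ ρx≤ρa a⋖b → ≤-trans (m≤n⇒m≤1+n ρx≤ρa) (≤-reflexive (sym (rank-cover a⋖b)))

    rank-strict : ∀ {x y} → x ≺ y → ρ x < ρ y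
    rank-strict x≺y with cover-below x≺y
    ... | w , x≼w , w⋖y = ≤-trans (s≤s (rank-mono x≼w)) (≤-reflexive (sym (rank-cover w⋖y)))

    ≼-rank-≡⇒≡ : ∀ {x y} → x ≼ y → ρ x ≡ ρ y → x ≡ y
    ≼-rank-≡⇒≡ {x} {y} x≼y ρx≡ρy =
      decidable-stable (_≟_ L x y) λ x≢y → <⇒≢ (rank-strict (x≼y , x≢y)) ρx≡ρy

    rank-0⇒bot : ∀ {x} → ρ x ≡ 0 → x ≡ bot L
    rank-0⇒bot {x} ρx≡0 = sym (≼-rank-≡⇒≡ (bot-min L x) (trans rank-bot (sym ρx≡0)))

    rank-suc⇒≢bot : ∀ {x r} → ρ x ≡ suc r → x ≢ bot L
    rank-suc⇒≢bot ρx≡1+r refl = 0≢1+n (trans (sym rank-bot) ρx≡1+r)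

    rank-≤-top : ∀ x → ρ x ≤ ρ (top L)
    rank-≤-top x = rank-mono (top-max L x)

    rank-suc⇒cover : ∀ {x y} → x ≼ y → ρ y ≡ suc (ρ x) → x ⋖ y
    rank-suc⇒cover {x} {y} x≼y ρy≡1+ρx = (x≼y , x≢y) , maximal
      where
      x≢y : x ≢ y
      x≢y refl = 1+n≢n (sym ρy≡1+ρx)
      maximal : ∀ z → x ≺ z → z ≼ y → z ≡ y
      maximal z x≺z z≼y = ≼-rank-≡⇒≡ z≼y (≤-antisym (rank-mono z≼y)
        (subst (_≤ ρ z) (sym ρy≡1+ρx) (rank-strict x≺z)))

-- f embeds L onto the interval [u, v] of M.  Both ι_n (onto [0, t_n]) and the inverse
-- of θ_s (onto [s, 1]) are of this form.
record IntervalEmbedding (L M : FinLattice) (f : Carrier L → Carrier M) (u v : Carrier M) : Set where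
  field
    order : ∀ {x y} → _⊑_ L x y ⇔ _⊑_ M (f x) (f y)
    image : ∀ {y} → (_⊑_ M u y × _⊑_ M y v) ⇔ ∃ λ x → f x ≡ y

module _ {L M : FinLattice} {f : Carrier L → Carrier M} {u v : Carrier M}
         (emb : IntervalEmbedding L M f u v) where

  open IntervalEmbedding emb
  private
    _≼_ = _⊑_ M

  embedding-injective : ∀ {x y} → f x ≡ f y → x ≡ y
  embedding-injective {x} {y} fx≡fy = ⊑-antisym L
    (Equivalence.from order (subst (f x ≼_) fx≡fy (⊑-refl M (f x))))
    (Equivalence.from order (subst (_≼ f x) fx≡fy (⊑-refl M (f x))))

  embedding-in-interval : ∀ x → u ≼ f x × f x ≼ v
  embedding-in-interval x = Equivalence.from image (x , refl)

  private
    u≼v : u ≼ v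
    u≼v = let u≼f⊥ , f⊥≼v = embedding-in-interval (bot L) in ⊑-trans M u≼f⊥ f⊥≼v

  embedding-bot : f (bot L) ≡ u
  embedding-bot with Equivalence.to image (⊑-refl M u , u≼v)
  ... | x , fx≡u = ⊑-antisym M (subst (f (bot L) ≼_) fx≡u (Equivalence.to order (bot-min L x)))
                               (proj₁ (embedding-in-interval (bot L)))

  embedding-onto-above : ∀ x {y} → f x ≼ y → y ≼ v → ∃ λ x′ → f x′ ≡ y
  embedding-onto-above x fx≼y y≼v = Equivalence.to image (⊑-trans M (proj₁ (embedding-in-interval x)) fx≼y , y≼v)

  embedding-≺ : ∀ {x y} → Lt L x y ⇔ Lt M (f x) (f y)
  embedding-≺ = mk⇔ (λ (x≼y , x≢y) → Equivalence.to order x≼y , x≢y ∘ embedding-injective)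
                    (λ (fx≼fy , fx≢fy) → Equivalence.from order fx≼fy , fx≢fy ∘ cong f)

  embedding-cover : ∀ {x y} → Covers L x y ⇔ Covers M (f x) (f y)
  embedding-cover {x} {y} = mk⇔ to from
    where
    to : Covers L x y → Covers M (f x) (f y)
    to (x≺y , maximal) = Equivalence.to embedding-≺ x≺y , maximal′
      where
      maximal′ : ∀ z → Lt M (f x) z → z ≼ f y → z ≡ f y
      maximal′ z fx≺z z≼fy
        with embedding-onto-above x (proj₁ fx≺z) (⊑-trans M z≼fy (proj₂ (embedding-in-interval y)))
      ... | w , refl = cong f (maximal w (Equivalence.from embedding-≺ fx≺z) (Equivalence.from order z≼fy))
    from : Covers M (f x) (f y) → Covers L x y
    from (fx≺fy , maximal) = Equivalence.from embedding-≺ fx≺fy , maximal′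
      where
      maximal′ : ∀ z → Lt L x z → _⊑_ L z y → z ≡ y
      maximal′ z x≺z z≼y =
        embedding-injective (maximal (f z) (Equivalence.to embedding-≺ x≺z) (Equivalence.to order z≼y))

  embedding-rank : ∀ {ρ σ} → IsGradedBy L ρ → IsGradedBy M σ → ∀ x → σ (f x) ≡ σ u + ρ x
  embedding-rank {ρ} {σ} gradedL gradedM x =
    FiniteOrder.cover-induction L (λ x → σ (f x) ≡ σ u + ρ x) base next (bot-min L x)
    where
    base : σ (f (bot L)) ≡ σ u + ρ (bot L)
    base = begin
      σ (f (bot L)) ≡⟨ cong σ embedding-bot ⟩
      σ u           ≡⟨ +-identityʳ (σ u) ⟨
      σ u + 0       ≡⟨ cong (λ k → σ u + k) (proj₁ gradedL) ⟨
      σ u + ρ (bot L) ∎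
      where open ≡-Reasoning
    next : ∀ {a b} → _⊑_ L (bot L) a → σ (f a) ≡ σ u + ρ a → Covers L a b → σ (f b) ≡ σ u + ρ b
    next {a} {b} _ ih a⋖b = begin
      σ (f b)            ≡⟨ proj₂ gradedM _ _ (Equivalence.to embedding-cover a⋖b) ⟩
      suc (σ (f a))      ≡⟨ cong suc ih ⟩
      suc (σ u + ρ a)    ≡⟨ +-suc (σ u) (ρ a) ⟨
      σ u + suc (ρ a)    ≡⟨ cong (λ k → σ u + k) (proj₂ gradedL _ _ a⋖b) ⟨
      σ u + ρ b          ∎
      where open ≡-Reasoning

  embedding-count-covers : ∀ x → count M (FiniteOrder._⋖?_ M (f x) ∩? λ y → _⊑?_ M y v) ≡
                                 count L (FiniteOrder._⋖?_ L x)
  embedding-count-covers x = sym (count-image L M (FiniteOrder._⋖?_ L x) _ f embedding-injective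
    (λ {y} x⋖y → Equivalence.to embedding-cover x⋖y , proj₂ (embedding-in-interval y))
    λ (fx⋖y , y≼v) → case embedding-onto-above x (proj₁ (proj₁ fx⋖y)) y≼v of λ where
      (w , refl) → w , Equivalence.from embedding-cover fx⋖y , refl)

module UniformSequence (U : UniformSeq) where

  open UniformSeq U

  graded : ∀ n → IsGradedBy (L n) (ρ n)
  graded n = proj₁ (proj₁ (geometric n))

  private
    module O n = FiniteOrder (L n)
    module G n = FiniteOrder.Graded (L n) (graded n)

  rank-≤ : ∀ n x → ρ n x ≤ n
  rank-≤ n x = ≤-trans (G.rank-≤-top n x) (≤-reflexive (rank-top n))

  ι-embedding : ∀ n → IntervalEmbedding (L n) (L (suc n)) (ι n) (bot (L (suc n))) (t n)
  ι-embedding n = record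
    { order = proj₁ (ι-emb n) _ _
    ; image = mk⇔ (Equivalence.to (proj₂ (ι-emb n) _) ∘ proj₂)
                  (λ ιx≡y → bot-min (L (suc n)) _ , Equivalence.from (proj₂ (ι-emb n) _) ιx≡y)
    }

  ι-rank : ∀ n x → ρ (suc n) (ι n x) ≡ ρ n x
  ι-rank n x = trans (embedding-rank (ι-embedding n) (graded n) (graded (suc n)) x)
                     (cong (_+ ρ n x) (G.rank-bot (suc n)))

  ι-injective : ∀ n {x y} → ι n x ≡ ι n y → x ≡ y
  ι-injective n = embedding-injective (ι-embedding n)

  module _ (n : ℕ) {s : Carrier (L (suc n))} (atom : IsAtom (L (suc n)) s) where

    private
      iso = θ-iso n s atom
      θs = θ n s

    θ⁻¹ : Carrier (L n) → Carrier (L (suc n))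
    θ⁻¹ m = proj₁ (proj₂ iso m)

    private
      θ⁻¹-above : ∀ m → _⊑_ (L (suc n)) s (θ⁻¹ m)
      θ⁻¹-above m = proj₁ (proj₂ (proj₂ iso m))

      θ∘θ⁻¹ : ∀ m → θs (θ⁻¹ m) ≡ m
      θ∘θ⁻¹ m = proj₂ (proj₂ (proj₂ iso m))

      θ-order : ∀ {x y} → _⊑_ (L (suc n)) s x → _⊑_ (L (suc n)) s y →
                _⊑_ (L (suc n)) x y ⇔ _⊑_ (L n) (θs x) (θs y)
      θ-order s≼x s≼y = proj₁ iso _ _ s≼x s≼y

      θ-injective : ∀ {x y} → _⊑_ (L (suc n)) s x → _⊑_ (L (suc n)) s y → θs x ≡ θs y → x ≡ y
      θ-injective {x} s≼x s≼y θx≡θy = ⊑-antisym (L (suc n))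
        (Equivalence.from (θ-order s≼x s≼y) (subst (_⊑_ (L n) (θs x)) θx≡θy (⊑-refl (L n) _)))
        (Equivalence.from (θ-order s≼y s≼x) (subst (λ m → _⊑_ (L n) m (θs x)) θx≡θy (⊑-refl (L n) _)))

    θ⁻¹-embedding : IntervalEmbedding (L n) (L (suc n)) θ⁻¹ s (top (L (suc n)))
    θ⁻¹-embedding = record
      { order = λ {m m′} → mk⇔
          (λ m≼m′ → Equivalence.from (θ-order (θ⁻¹-above m) (θ⁻¹-above m′))
                                      (subst₂ (_⊑_ (L n)) (sym (θ∘θ⁻¹ m)) (sym (θ∘θ⁻¹ m′)) m≼m′))
          (λ θ⁻¹m≼θ⁻¹m′ → subst₂ (_⊑_ (L n)) (θ∘θ⁻¹ m) (θ∘θ⁻¹ m′)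
                                      (Equivalence.to (θ-order (θ⁻¹-above m) (θ⁻¹-above m′)) θ⁻¹m≼θ⁻¹m′))
      ; image = mk⇔ (λ (s≼y , _) → θs _ , θ-injective (θ⁻¹-above _) s≼y (θ∘θ⁻¹ _))
                    (λ { (m , refl) → θ⁻¹-above m , top-max (L (suc n)) _ })
      }

    θ⁻¹-rank : ∀ m → ρ (suc n) (θ⁻¹ m) ≡ suc (ρ n m)
    θ⁻¹-rank m = trans (embedding-rank θ⁻¹-embedding (graded n) (graded (suc n)) m)
                       (cong (_+ ρ n m) (trans (G.rank-cover (suc n) atom) (cong suc (G.rank-bot (suc n)))))

  rank? : ∀ n r → Decidable (λ x → ρ n x ≡ r)
  rank? n r x = ρ n x ≟ℕ r

  whitney : ℕ → ℕ → ℕ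
  whitney n r = count (L n) (rank? n r)

  whitney-0 : ∀ n → whitney n 0 ≡ 1
  whitney-0 n = count-enumeration (L n) _ (All.[] ∷ [])
    (mk⇔ (λ { (here refl) → G.rank-bot n }) (λ ρx≡0 → here (G.rank-0⇒bot n ρx≡0)))

  whitney-above : ∀ n r → n < r → whitney n r ≡ 0
  whitney-above n r n<r = count-enumeration (L n) _ []
    (mk⇔ (λ ()) (λ ρx≡r → contradiction (subst (_≤ n) ρx≡r (rank-≤ n _)) (<⇒≱ n<r)))

  module _ (n : ℕ) where

    private
      M = L (suc n)

    below-t? : Decidable (λ y → _⊑_ M y (t n))
    below-t? y = _⊑?_ M y (t n)

    whitney-below-t : ∀ k → whitney n k ≡ count M (rank? (suc n) k ∩? below-t?)
    whitney-below-t k = count-image (L n) M _ _ (ι n) (ι-injective n)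
      (λ {x} ρx≡k → trans (ι-rank n x) ρx≡k , proj₂ (embedding-in-interval (ι-embedding n) x))
      λ (ρy≡k , y≼t) → case Equivalence.to (IntervalEmbedding.image (ι-embedding n)) (bot-min M _ , y≼t) of λ where
        (x , refl) → x , trans (sym (ι-rank n x)) ρy≡k , refl

    join-t : ∀ {y} → ¬ _⊑_ M y (t n) → _∨_ M (t n) y ≡ top M
    join-t {y} y⋢t = proj₂ (t-coatom n) _ (∨-upperˡ M (t n) y , t≢t∨y) (top-max M _)
      where
      t≢t∨y : t n ≢ _∨_ M (t n) y
      t≢t∨y t≡t∨y = y⋢t (subst (_⊑_ M y) (sym t≡t∨y) (∨-upperʳ M (t n) y))

    meet-t-rank : ∀ {y r} → ¬ _⊑_ M y (t n) → ρ (suc n) y ≡ suc r → ρ (suc n) (_∧_ M (t n) y) ≡ r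
    meet-t-rank {y} {r} y⋢t ρy≡1+r = +-cancelˡ-≡ (suc n) _ _ (begin
      suc n + ρ (suc n) t∧y                        ≡⟨ cong (_+ ρ (suc n) t∧y) (rank-top (suc n)) ⟨
      ρ (suc n) (top M) + ρ (suc n) t∧y            ≡⟨ cong (λ w → ρ (suc n) w + ρ (suc n) t∧y) (join-t y⋢t) ⟨
      ρ (suc n) (_∨_ M (t n) y) + ρ (suc n) t∧y    ≡⟨ t-modular n y ⟨
      ρ (suc n) (t n) + ρ (suc n) y                ≡⟨ cong₂ _+_ rank-t ρy≡1+r ⟩
      n + suc r                                    ≡⟨ +-suc n r ⟩
      suc n + r                                    ∎)
      where
      open ≡-Reasoning
      t∧y = _∧_ M (t n) y
      rank-t : ρ (suc n) (t n) ≡ n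
      rank-t = suc-injective (trans (sym (G.rank-cover (suc n) (t-coatom n))) (rank-top (suc n)))

    meet-t-covered : ∀ {y r} → ¬ _⊑_ M y (t n) → ρ (suc n) y ≡ suc r → Covers M (_∧_ M (t n) y) y
    meet-t-covered {y} y⋢t ρy≡1+r =
      G.rank-suc⇒cover (suc n) (∧-lowerʳ M (t n) y) (trans ρy≡1+r (cong suc (sym (meet-t-rank y⋢t ρy≡1+r))))

    meet-t-of-cover : ∀ {z y} → _⊑_ M z (t n) → Covers M z y → ¬ _⊑_ M y (t n) → _∧_ M (t n) y ≡ z
    meet-t-of-cover {z} {y} z≼t ((z≼y , _) , maximal) y⋢t = decidable-stable (_≟_ M _ z) λ t∧y≢z →
      y⋢t (subst (λ w → _⊑_ M w (t n)) (maximal _ (z≼t∧y , t∧y≢z ∘ sym) (∧-lowerʳ M (t n) y))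
                 (∧-lowerˡ M (t n) y))
      where
      z≼t∧y : _⊑_ M z (_∧_ M (t n) y)
      z≼t∧y = ∧-greatest M z≼t z≼y

  module _ (A : ℕ → ℕ) (atom-count : ∀ n → HasAtomCount (L n) (A n)) where

    upper-cover-count : ∀ r n z → ρ n z ≡ r → count (L n) (O._⋖?_ n z) ≡ A (n ∸ r)
    upper-cover-count zero n z ρz≡0 with G.rank-0⇒bot n ρz≡0 | atom-count n
    ... | refl | atoms , unique , all-atoms , complete-atoms , length≡A =
      trans (count-enumeration (L n) (O._⋖?_ n z) unique (mk⇔ (All.lookup all-atoms) (complete-atoms _))) length≡A
    upper-cover-count (suc r) zero z ρz≡1+r =
      contradiction (subst (_≤ 0) ρz≡1+r (rank-≤ 0 z)) λ ()
    upper-cover-count (suc r) (suc n) z ρz≡1+r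
      with O.atom-below (suc n) (proj₂ (geometric (suc n))) (G.rank-suc⇒≢bot (suc n) ρz≡1+r)
    ... | s , atom , s≼z
      with Equivalence.to (IntervalEmbedding.image (θ⁻¹-embedding n atom)) (s≼z , top-max (L (suc n)) z)
    ... | m , refl = begin
      count (L (suc n)) (O._⋖?_ (suc n) (θ⁻¹ n atom m))
        ≡⟨ count-cong (L (suc n)) _ _ (mk⇔ (λ c → c , top-max (L (suc n)) _) proj₁) ⟩
      count (L (suc n)) (O._⋖?_ (suc n) (θ⁻¹ n atom m) ∩? λ y → _⊑?_ (L (suc n)) y (top (L (suc n))))
        ≡⟨ embedding-count-covers (θ⁻¹-embedding n atom) m ⟩
      count (L n) (O._⋖?_ n m)
        ≡⟨ upper-cover-count r n m (suc-injective (trans (sym (θ⁻¹-rank n atom m)) ρz≡1+r)) ⟩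
      A (n ∸ r) ∎
      where open ≡-Reasoning

    fibre-size : ∀ n r {z} → _⊑_ (L (suc n)) z (t n) → ρ (suc n) z ≡ r →
                 count (L (suc n)) (O._⋖?_ (suc n) z ∩? ∁? (below-t? n)) + A (n ∸ r) ≡ A (suc n ∸ r)
    fibre-size n r {z} z≼t ρz≡r
      with Equivalence.to (IntervalEmbedding.image (ι-embedding n)) (bot-min (L (suc n)) z , z≼t)
    ... | x , refl = begin
      count M (covers ∩? ∁? (below-t? n)) + A (n ∸ r)
        ≡⟨ cong (λ k → count M (covers ∩? ∁? (below-t? n)) + k)
                (trans (sym (upper-cover-count r n x (trans (sym (ι-rank n x)) ρz≡r)))
                       (sym (embedding-count-covers (ι-embedding n) x))) ⟩
      count M (covers ∩? ∁? (below-t? n)) + count M (covers ∩? below-t? n)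
        ≡⟨ +-comm (count M (covers ∩? ∁? (below-t? n))) _ ⟩
      count M (covers ∩? below-t? n) + count M (covers ∩? ∁? (below-t? n))
        ≡⟨ count-partition M covers (below-t? n) ⟨
      count M covers
        ≡⟨ upper-cover-count r (suc n) (ι n x) ρz≡r ⟩
      A (suc n ∸ r) ∎
      where
      open ≡-Reasoning
      M = L (suc n)
      covers = O._⋖?_ (suc n) (ι n x)

    whitney-rec : ∀ n r → whitney (suc n) (suc r) + A (n ∸ r) * whitney n r ≡
                          whitney n (suc r) + A (suc n ∸ r) * whitney n r
    whitney-rec n r = begin
      whitney (suc n) (suc r) + a * whitney n r
        ≡⟨ cong (_+ a * whitney n r) (count-partition M (rank? (suc n) (suc r)) (below-t? n)) ⟩
      (count M (rank? (suc n) (suc r) ∩? below-t? n) + count M P?) + a * whitney n r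
        ≡⟨ +-assoc (count M (rank? (suc n) (suc r) ∩? below-t? n)) _ _ ⟩
      count M (rank? (suc n) (suc r) ∩? below-t? n) + (count M P? + a * whitney n r)
        ≡⟨ cong₂ _+_ (sym (whitney-below-t n (suc r))) fibres ⟩
      whitney n (suc r) + b * whitney n r ∎
      where
      open ≡-Reasoning
      M = L (suc n)
      a = A (n ∸ r)
      b = A (suc n ∸ r)
      P? = rank? (suc n) (suc r) ∩? ∁? (below-t? n)
      -- y ↦ t ∧ y maps the elements counted by P? onto the rank-r elements below t;
      -- the fibre over z consists of the covers of z not below t.
      fibres : count M P? + a * whitney n r ≡ b * whitney n r
      fibres = subst (λ w → count M P? + a * w ≡ b * w) (sym (whitney-below-t n r))
        (count-fibres M P? (rank? (suc n) r ∩? below-t? n) (λ z → O._⋖?_ (suc n) z ∩? ∁? (below-t? n)) (_∧_ M (t n))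
          (λ (ρy≡1+r , y⋢t) → (meet-t-rank n y⋢t ρy≡1+r , ∧-lowerˡ M (t n) _) ,
                              meet-t-covered n y⋢t ρy≡1+r , y⋢t)
          (λ (ρz≡r , _) (z⋖y , y⋢t) → trans (G.rank-cover (suc n) z⋖y) (cong suc ρz≡r) , y⋢t)
          (λ (_ , z≼t) (z⋖y , y⋢t) → meet-t-of-cover n z≼t z⋖y y⋢t)
          a b (λ (ρz≡r , z≼t) → fibre-size n r z≼t ρz≡r))

module DirectLimit (U : UniformSeq) where

  open UniformSeq U
  open UniformSequence U using (ι-injective; ι-rank; rank?; whitney)

  up : El U → El U
  up (m , x) = suc m , ι m x

  upBy : ℕ → El U → El U
  upBy zero    e = e
  upBy (suc d) e = up (upBy d e)

  upBy-level : ∀ d e → proj₁ (upBy d e) ≡ d + proj₁ e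
  upBy-level zero    e = refl
  upBy-level (suc d) e = cong suc (upBy-level d e)

  upBy-≡⇒level-≡ : ∀ d d′ {e e′} → upBy d e ≡ upBy d′ e′ → d + proj₁ e ≡ d′ + proj₁ e′
  upBy-≡⇒level-≡ d d′ {e} {e′} eq = trans (sym (upBy-level d e)) (trans (cong proj₁ eq) (upBy-level d′ e′))

  upBy-+ : ∀ d d′ e → upBy (d + d′) e ≡ upBy d (upBy d′ e)
  upBy-+ zero    d′ e = refl
  upBy-+ (suc d) d′ e = cong up (upBy-+ d d′ e)

  up-injective : ∀ {e e′} → up e ≡ up e′ → e ≡ e′
  up-injective {m , x} {m′ , y} ιx≡ιy with suc-injective (cong proj₁ ιx≡ιy)
  ... | refl = cong (m ,_) (ι-injective m (,-injectiveʳ ιx≡ιy))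

  upBy-injective : ∀ d {e e′} → upBy d e ≡ upBy d e′ → e ≡ e′
  upBy-injective zero    eq = eq
  upBy-injective (suc d) eq = upBy-injective d (up-injective eq)

  CommonUpper : El U → El U → Set
  CommonUpper e e′ = ∃₂ λ d d′ → upBy d e ≡ upBy d′ e′

  ∼⇒CommonUpper : ∀ {e e′} → _∼_ U e e′ → CommonUpper e e′
  ∼⇒CommonUpper (step n x) = 1 , 0 , refl
  ∼⇒CommonUpper (∼refl e)  = 0 , 0 , refl
  ∼⇒CommonUpper (∼sym e∼e′) with ∼⇒CommonUpper e∼e′
  ... | d , d′ , eq = d′ , d , sym eq
  ∼⇒CommonUpper {e} {e″} (∼trans {_} {e′} e∼e′ e′∼e″)
    with ∼⇒CommonUpper e∼e′ | ∼⇒CommonUpper e′∼e″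
  ... | d₁ , d₂ , eq₁ | d₃ , d₄ , eq₂ = d₃ + d₁ , d₂ + d₄ , (begin
    upBy (d₃ + d₁) e        ≡⟨ upBy-+ d₃ d₁ e ⟩
    upBy d₃ (upBy d₁ e)     ≡⟨ cong (upBy d₃) eq₁ ⟩
    upBy d₃ (upBy d₂ e′)    ≡⟨ upBy-+ d₃ d₂ e′ ⟨
    upBy (d₃ + d₂) e′       ≡⟨ cong (λ d → upBy d e′) (+-comm d₃ d₂) ⟩
    upBy (d₂ + d₃) e′       ≡⟨ upBy-+ d₂ d₃ e′ ⟩
    upBy d₂ (upBy d₃ e′)    ≡⟨ cong (upBy d₂) eq₂ ⟩
    upBy d₂ (upBy d₄ e″)    ≡⟨ upBy-+ d₂ d₄ e″ ⟨
    upBy (d₂ + d₄) e″       ∎)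
    where open ≡-Reasoning

  -- Lifting is injective and raises all levels by the same amount.
  ∼-same-level : ∀ {N x y} → _∼_ U (N , x) (N , y) → x ≡ y
  ∼-same-level {N} {x} {y} x∼y with ∼⇒CommonUpper x∼y
  ... | d , d′ , eq with +-cancelʳ-≡ N d d′ (upBy-≡⇒level-≡ d d′ eq)
  ... | refl = ,-injectiveʳ (upBy-injective d eq)

  ∼-rank : ∀ {e e′} → _∼_ U e e′ → rankEl U e ≡ rankEl U e′
  ∼-rank (step n x)          = sym (ι-rank n x)
  ∼-rank (∼refl e)           = refl
  ∼-rank (∼sym e∼e′)         = sym (∼-rank e∼e′)
  ∼-rank (∼trans e∼e′ e′∼e″) = trans (∼-rank e∼e′) (∼-rank e′∼e″)

  representative-at : ∀ {m N} (x : Carrier (L m)) → m ≤′ N → ∃ λ y → _∼_ U (m , x) (N , y)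
  representative-at x ≤′-refl        = x , ∼refl _
  representative-at x (≤′-step m≤′N) with representative-at x m≤′N
  ... | y , x∼y = ι _ y , ∼trans x∼y (step _ y)

  rankSlice : ℕ → ℕ → List (El U)
  rankSlice N r = map (N ,_) (filter (rank? N r) (enum (L N)))

  length-rankSlice : ∀ N r → length (rankSlice N r) ≡ whitney N r
  length-rankSlice N r = length-map _ (filter (rank? N r) (enum (L N)))

  rankSlice-transversal : ∀ k r → 1 ≤ k → RankTransversal U k r (rankSlice (r + k ∸ 1) r)
  rankSlice-transversal k r 1≤k = sound , distinct , exhaustive
    where
    N = r + k ∸ 1
    N<r+k : N < r + k
    N<r+k = ∸-monoʳ-< (s≤s z≤n) (≤-trans 1≤k (m≤n+m k r))
    rank-member : ∀ {x} → x ∈ filter (rank? N r) (enum (L N)) → ρ N x ≡ r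
    rank-member = Equivalence.to (∈-filter-enum (L N) (rank? N r))
    sound : All.All (λ e → InLk U k e × rankEl U e ≡ r) (rankSlice N r)
    sound = AllP.map⁺ (All.tabulate λ x∈ →
      (_ , ∼refl _ , subst (λ ρx → N < ρx + k) (sym (rank-member x∈)) N<r+k) , rank-member x∈)
    distinct : AllPairs.AllPairs (λ e e′ → ¬ _∼_ U e e′) (rankSlice N r)
    distinct = AllPairsP.map⁺
      (AllPairs.map (λ x≢y x∼y → x≢y (∼-same-level x∼y)) (unique-filter-enum (L N) (rank? N r)))
    exhaustive : ∀ e → InLk U k e → rankEl U e ≡ r → Any.Any (_∼_ U e) (rankSlice N r)
    exhaustive e ((m , y) , e∼y , m<ρy+k) ρe≡r =
      let ρy≡r = trans (sym (∼-rank e∼y)) ρe≡r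
          x , y∼x = representative-at y (≤⇒≤′ (∸-monoˡ-≤ 1 (subst (λ ρy → suc m ≤ ρy + k) ρy≡r m<ρy+k)))
      in AnyP.map⁺ (lose (Equivalence.from (∈-filter-enum (L N) (rank? N r)) (trans (sym (∼-rank y∼x)) ρy≡r))
                         (∼trans e∼y y∼x))

corollary3p17 : (U : UniformSeq) (A : ℕ → ℕ) →
    (∀ n → HasAtomCount (UniformSeq.L U n) (A n)) →
    (k : ℕ) → 1 ≤ k →
    Σ (ℕ → List (El U)) λ T →
      (∀ r → RankTransversal U k r (T r)) ×
      (∀ r → seriesMul (linProd (aList A k)) (λ j → + length (T j)) r ≡ δ₀ r)
corollary3p17 U A atom-count k 1≤k =
  (λ r → rankSlice (r + k ∸ 1) r) , (λ r → rankSlice-transversal k r 1≤k) , λ r → begin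
    seriesMul (linProd (aList A k)) (λ j → + length (rankSlice (j + k ∸ 1) j)) r
      ≡⟨ seriesMul-cong (λ _ → refl) (λ j → cong +_ (length-rankSlice (j + k ∸ 1) j)) r ⟩
    seriesMul (linProd (aList A k)) (λ j → + whitney (j + k ∸ 1) j) r
      ≡⟨ generating-function A whitney whitney-0 whitney-above (whitney-rec A atom-count) k r ⟩
    δ₀ r ∎
  where
  open UniformSequence U
  open DirectLimit U
  open ≡-Reasoning
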